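{- There is an absolute constant $c>0$ such that the following holds. Let $n,k$ be integers with $2 \le k \le n/2$, $p = k/n$, and let $x$ be uniformly random in $\binom{[n]}{k}$. Let $S \subseteq [n]$ with $t = |S|$ satisfying $2 \le t \le \frac{3}{2}p^{ -1}$. Then $\Pr[\sum_{i \in S} x_i \ge 2] \ge c\,(pt)^2$.
   Context: $\binom{[n]}{k} = \{x \in \{0,1\}^n : \sum_i x_i = k\}$. -}

module Defs where

open import Data.Nat using (ℕ; zero; suc; _≤?_)
open import Data.Nat.Properties using (_≟_)
open import Data.Bool using (true; false)
open import Data.List using (List; []; _∷_; map; _++_; filter; length)
open import Data.Vec using (_∷_; [])
open import Data.Fin.Subset using (Subset; ∣_∣; _∩_)
open import Relation.Nullary.Decidable using (_×-dec_)

-- all 2^n elements of {0,1}^n (subsets of [n]), each listed exactly once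
allSubsets : (n : ℕ) → List (Subset n)
allSubsets zero = [] ∷ []
allSubsets (suc n) = map (true ∷_) (allSubsets n) ++ map (false ∷_) (allSubsets n)

sliceSize : (n k : ℕ) → ℕ
sliceSize n k = length (filter (λ x → ∣ x ∣ ≟ k) (allSubsets n))

goodCount : (n k : ℕ) → Subset n → ℕ
goodCount n k S = length (filter (λ x → (∣ x ∣ ≟ k) ×-dec (2 ≤? ∣ x ∩ S ∣)) (allSubsets n))

-- Write n = 2 + N, k = 2 + K, t = ∣S∣ and pick m with 3m ≤ t ≤ 3m + 2.  Shrink S to a subset T of
-- size 2 + m and count only the x meeting T in exactly two points: there are C(2+m, 2) C(N-m, K)
-- of them.  The hypothesis 2tk ≤ 3n gives 2mK ≤ N, so by the union bound a random K-subset of [N]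
-- avoids m given points with probability at least 1/2, i.e. C(N-m, K) ≥ C(N, K)/2.  Absorption
-- gives k(k-1) C(n, k) = n(n-1) C(N, K), hence k² C(n, k) ≤ 2n² C(N, K); and t² ≤ 18 C(2+m, 2).
-- Multiplying, (kt)² C(n, k) ≤ 72 n² C(2+m, 2) C(N-m, K) ≤ 72 n² · goodCount.
module Submission where

open import Defs
open import Data.Nat using (ℕ; _*_; _≤_; _<_; _^_)
open import Data.Product using (Σ; _×_)
open import Data.Fin.Subset using (Subset; ∣_∣)

open import Level using (Level; 0ℓ)
open import Function using (_∘_)
open import Data.Bool.Base using (true; false)
open import Data.Nat.Base using (zero; suc; pred; _+_; _∸_; z≤n; s≤s)
open import Data.Nat.Properties
open import Data.Nat.Combinatorics using (_C_; nCk+nC[k+1]≡[n+1]C[k+1]; nC1≡n)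
open import Data.Nat.DivMod using (_/_; _%_; m≡m%n+[m/n]*n; m%n<n; m/n*n≤m)
open import Data.Nat.Tactic.RingSolver using (solve)
open import Algebra.Properties.CommutativeSemigroup *-commutativeSemigroup using (x∙yz≈y∙xz)
open import Data.Product using (∃-syntax; _,_; proj₁; proj₂; map₁; map₂)
open import Data.List.Base using (List; []; _∷_; _++_; map; filter; length)
open import Data.List.Properties using (length-map; length-++; filter-++; filter-≐; filter-none)
open import Data.List.Relation.Unary.All using (universal)
import Data.List.Relation.Binary.Sublist.Propositional as Sublist
import Data.List.Relation.Binary.Sublist.Propositional.Properties as Sublist
open import Data.Fin.Subset using (inside; outside; _∩_; _─_; ∁; ⊤; ⊥; _⊆_)
open import Data.Fin.Subset.Properties
  using (∣⊥∣≡0; ∣⊤∣≡n; ∣∁p∣≡n∸∣p∣; p⊆q⇒∣p∣≤∣q∣; p─⊤≡⊥; ∩-identityʳ; ⊆-min; s⊆s; x∈p∩q⁺; x∈p∩q⁻)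
open import Relation.Nullary using (does; ¬_)
open import Relation.Nullary.Decidable using (_×-dec_)
open import Relation.Unary using (Pred; Decidable)
open import Relation.Binary.PropositionalEquality

private variable
  a b ℓ ℓ′ : Level
  A : Set a
  B : Set b

[n+1]*nCk≡[k+1]*[n+1]C[k+1] : ∀ n k → suc n * (n C k) ≡ suc k * (suc n C suc k)
[n+1]*nCk≡[k+1]*[n+1]C[k+1] zero    zero    = refl
[n+1]*nCk≡[k+1]*[n+1]C[k+1] zero    (suc k) = sym (*-zeroʳ (2 + k))
[n+1]*nCk≡[k+1]*[n+1]C[k+1] (suc n) zero    =
  trans (*-identityʳ (2 + n)) (sym (trans (*-identityˡ _) (nC1≡n (2 + n))))
[n+1]*nCk≡[k+1]*[n+1]C[k+1] (suc n) (suc k) = begin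
  (2 + n) * X                        ≡⟨ cong (λ z → X + suc n * z) (nCk+nC[k+1]≡[n+1]C[k+1] n k) ⟨
  X + suc n * (n C k + n C suc k)    ≡⟨ cong (X +_) (*-distribˡ-+ (suc n) (n C k) _) ⟩
  X + (suc n * (n C k) + suc n * (n C suc k))
    ≡⟨ cong₂ (λ u v → X + (u + v)) ([n+1]*nCk≡[k+1]*[n+1]C[k+1] n k)
                                   ([n+1]*nCk≡[k+1]*[n+1]C[k+1] n (suc k)) ⟩
  X + (suc k * X + (2 + k) * Y)      ≡⟨ +-assoc X (suc k * X) _ ⟨
  (2 + k) * X + (2 + k) * Y          ≡⟨ *-distribˡ-+ (2 + k) X Y ⟨
  (2 + k) * (X + Y)                  ≡⟨ cong ((2 + k) *_) (nCk+nC[k+1]≡[n+1]C[k+1] (suc n) (suc k)) ⟩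
  (2 + k) * ((2 + n) C (2 + k))      ∎
  where
  open ≡-Reasoning
  X = suc n C suc k
  Y = suc n C suc (suc k)

[2+k]*[1+k]*[2+n]C[2+k]≡[2+n]*[1+n]*nCk : ∀ n k →
  (2 + k) * (1 + k) * ((2 + n) C (2 + k)) ≡ (2 + n) * (1 + n) * (n C k)
[2+k]*[1+k]*[2+n]C[2+k]≡[2+n]*[1+n]*nCk n k = begin
  (2 + k) * (1 + k) * ((2 + n) C (2 + k))    ≡⟨ cong (_* ((2 + n) C (2 + k))) (*-comm (2 + k) (1 + k)) ⟩
  (1 + k) * (2 + k) * ((2 + n) C (2 + k))    ≡⟨ *-assoc (1 + k) (2 + k) ((2 + n) C (2 + k)) ⟩
  (1 + k) * ((2 + k) * ((2 + n) C (2 + k)))  ≡⟨ cong ((1 + k) *_) ([n+1]*nCk≡[k+1]*[n+1]C[k+1] (1 + n) (1 + k)) ⟨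
  (1 + k) * ((2 + n) * ((1 + n) C (1 + k)))  ≡⟨ x∙yz≈y∙xz (1 + k) (2 + n) ((1 + n) C (1 + k)) ⟩
  (2 + n) * ((1 + k) * ((1 + n) C (1 + k)))  ≡⟨ cong ((2 + n) *_) ([n+1]*nCk≡[k+1]*[n+1]C[k+1] n k) ⟨
  (2 + n) * ((1 + n) * (n C k))              ≡⟨ *-assoc (2 + n) (1 + n) (n C k) ⟨
  (2 + n) * (1 + n) * (n C k)                ∎
  where open ≡-Reasoning

C-monoˡ-≤ : ∀ k {m n} → m ≤ n → m C k ≤ n C k
C-monoˡ-≤ zero    _         = ≤-refl
C-monoˡ-≤ (suc k) z≤n       = z≤n
C-monoˡ-≤ (suc k) (s≤s m≤n) =
  subst₂ _≤_ (nCk+nC[k+1]≡[n+1]C[k+1] _ k) (nCk+nC[k+1]≡[n+1]C[k+1] _ k)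
    (+-mono-≤ (C-monoˡ-≤ k m≤n) (C-monoˡ-≤ (suc k) m≤n))

m≤n⇒n*mCk≤n*pred[m]Ck+k*nCk : ∀ {m n} k → m ≤ n → n * (m C k) ≤ n * (pred m C k) + k * (n C k)
m≤n⇒n*mCk≤n*pred[m]Ck+k*nCk {zero}  k       _         = m≤m+n _ _
m≤n⇒n*mCk≤n*pred[m]Ck+k*nCk {suc m} zero    _         = m≤m+n _ _
m≤n⇒n*mCk≤n*pred[m]Ck+k*nCk {suc m} {suc n} (suc k) (s≤s m≤n) = begin
  suc n * (suc m C suc k)                       ≡⟨ cong (suc n *_) (nCk+nC[k+1]≡[n+1]C[k+1] m k) ⟨
  suc n * (m C k + m C suc k)                   ≡⟨ *-distribˡ-+ (suc n) (m C k) _ ⟩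
  suc n * (m C k) + suc n * (m C suc k)         ≤⟨ +-monoˡ-≤ _ (*-monoʳ-≤ (suc n) (C-monoˡ-≤ k m≤n)) ⟩
  suc n * (n C k) + suc n * (m C suc k)         ≡⟨ cong (_+ suc n * (m C suc k)) ([n+1]*nCk≡[k+1]*[n+1]C[k+1] n k) ⟩
  suc k * (suc n C suc k) + suc n * (m C suc k) ≡⟨ +-comm (suc k * (suc n C suc k)) _ ⟩
  suc n * (m C suc k) + suc k * (suc n C suc k) ∎
  where open ≤-Reasoning

-- Divided by n · (n C k), this is the union bound: a random k-subset of [n] meets a fixed m-set
-- with probability at most mk/n.
n*nCk≤n*[n∸m]Ck+m*k*nCk : ∀ n m k → n * (n C k) ≤ n * ((n ∸ m) C k) + m * k * (n C k)
n*nCk≤n*[n∸m]Ck+m*k*nCk n zero    k = m≤m+n _ _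
n*nCk≤n*[n∸m]Ck+m*k*nCk n (suc m) k = begin
  n * (n C k)                                   ≤⟨ n*nCk≤n*[n∸m]Ck+m*k*nCk n m k ⟩
  n * ((n ∸ m) C k) + m * k * c                 ≤⟨ +-monoˡ-≤ _ (m≤n⇒n*mCk≤n*pred[m]Ck+k*nCk k (m∸n≤m n m)) ⟩
  n * (pred (n ∸ m) C k) + k * c + m * k * c    ≡⟨ cong (λ j → n * (j C k) + k * c + m * k * c) (pred[m∸n]≡m∸[1+n] n m) ⟩
  n * ((n ∸ suc m) C k) + k * c + m * k * c     ≡⟨ +-assoc (n * ((n ∸ suc m) C k)) _ _ ⟩
  n * ((n ∸ suc m) C k) + (k * c + m * k * c)   ≡⟨ cong (n * ((n ∸ suc m) C k) +_) (*-distribʳ-+ c k (m * k)) ⟨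
  n * ((n ∸ suc m) C k) + suc m * k * c         ∎
  where
  open ≤-Reasoning
  c = n C k

2*m*k≤n⇒nCk≤2*[n∸m]Ck : ∀ n m k → 2 * m * k ≤ n → n C k ≤ 2 * ((n ∸ m) C k)
2*m*k≤n⇒nCk≤2*[n∸m]Ck zero        m k _     rewrite 0∸n≡0 m = m≤m+n (0 C k) _
2*m*k≤n⇒nCk≤2*[n∸m]Ck n@(suc _) m k 2mk≤n =
  *-cancelˡ-≤ n (absorb-error n (n C k) ((n ∸ m) C k) 2mk≤n (n*nCk≤n*[n∸m]Ck+m*k*nCk n m k))
  where
  open ≤-Reasoning
  absorb-error : ∀ n c d → 2 * m * k ≤ n → n * c ≤ n * d + m * k * c → n * c ≤ n * (2 * d)
  absorb-error n c d 2mk≤n nc≤nd+mkc = +-cancelʳ-≤ (n * c) _ _ (begin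
    n * c + n * c               ≡⟨ solve (n ∷ c ∷ []) ⟩
    2 * (n * c)                 ≤⟨ *-monoʳ-≤ 2 nc≤nd+mkc ⟩
    2 * (n * d + m * k * c)     ≡⟨ solve (n ∷ m ∷ k ∷ c ∷ d ∷ []) ⟩
    n * (2 * d) + 2 * m * k * c ≤⟨ +-monoʳ-≤ _ (*-monoˡ-≤ c 2mk≤n) ⟩
    n * (2 * d) + n * c         ∎)

[2+k]^2*[2+n]C[2+k]≤2*[2+n]^2*nCk : ∀ n k → (2 + k) ^ 2 * ((2 + n) C (2 + k)) ≤ 2 * (2 + n) ^ 2 * (n C k)
[2+k]^2*[2+n]C[2+k]≤2*[2+n]^2*nCk n k =
  bound ((2 + n) C (2 + k)) (n C k) ([2+k]*[1+k]*[2+n]C[2+k]≡[2+n]*[1+n]*nCk n k)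
  where
  open ≤-Reasoning
  bound : ∀ X Y → (2 + k) * (1 + k) * X ≡ (2 + n) * (1 + n) * Y → (2 + k) ^ 2 * X ≤ 2 * (2 + n) ^ 2 * Y
  bound X Y eq = begin
    (2 + k) * ((2 + k) * 1) * X       ≤⟨ *-monoˡ-≤ X (*-monoʳ-≤ (2 + k) (*-monoˡ-≤ 1 (m≤m+n (2 + k) k))) ⟩
    (2 + k) * ((2 + k + k) * 1) * X   ≡⟨ solve (k ∷ X ∷ []) ⟩
    2 * ((2 + k) * (1 + k) * X)       ≡⟨ cong (2 *_) eq ⟩
    2 * ((2 + n) * (1 + n) * Y)       ≤⟨ *-monoʳ-≤ 2 (*-monoˡ-≤ Y (*-monoʳ-≤ (2 + n) (n≤1+n (1 + n)))) ⟩
    2 * ((2 + n) * (2 + n) * Y)       ≡⟨ solve (n ∷ Y ∷ []) ⟩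
    2 * ((2 + n) * ((2 + n) * 1)) * Y ∎

t≤2+3*m⇒t^2≤18*[2+m]C2 : ∀ t m → t ≤ 2 + 3 * m → t ^ 2 ≤ 18 * ((2 + m) C 2)
t≤2+3*m⇒t^2≤18*[2+m]C2 t m t≤2+3m = bound ((2 + m) C 2) 2*[2+m]C2≡[2+m]*[1+m]
  where
  open ≤-Reasoning
  2*[2+m]C2≡[2+m]*[1+m] : 2 * ((2 + m) C 2) ≡ (2 + m) * (1 + m)
  2*[2+m]C2≡[2+m]*[1+m] =
    trans (sym ([n+1]*nCk≡[k+1]*[n+1]C[k+1] (1 + m) 1)) (cong ((2 + m) *_) (nC1≡n (1 + m)))
  bound : ∀ X → 2 * X ≡ (2 + m) * (1 + m) → t ^ 2 ≤ 18 * X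
  bound X 2X≡[2+m]*[1+m] = begin
    t * (t * 1)                                     ≤⟨ *-mono-≤ t≤2+3m (*-monoˡ-≤ 1 t≤2+3m) ⟩
    (2 + 3 * m) * ((2 + 3 * m) * 1)                 ≤⟨ m≤m+n _ (14 + 15 * m) ⟩
    (2 + 3 * m) * ((2 + 3 * m) * 1) + (14 + 15 * m) ≡⟨ solve (m ∷ []) ⟩
    9 * ((2 + m) * (1 + m))                         ≡⟨ cong (9 *_) 2X≡[2+m]*[1+m] ⟨
    9 * (2 * X)                                     ≡⟨ solve (X ∷ []) ⟩
    18 * X                                          ∎

∃[m]3*m≤t≤2+3*m : ∀ t → ∃[ m ] 3 * m ≤ t × t ≤ 2 + 3 * m
∃[m]3*m≤t≤2+3*m t = t / 3 , subst (_≤ t) (*-comm (t / 3) 3) (m/n*n≤m t 3) , upper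
  where
  upper : t ≤ 2 + 3 * (t / 3)
  upper = begin
    t                  ≡⟨ m≡m%n+[m/n]*n t 3 ⟩
    t % 3 + t / 3 * 3  ≤⟨ +-mono-≤ (≤-pred (m%n<n t 3)) (≤-reflexive (*-comm (t / 3) 3)) ⟩
    2 + 3 * (t / 3)    ∎
    where open ≤-Reasoning

2≤t⇒3*m≤t⇒2+m≤t : ∀ {t} m → 2 ≤ t → 3 * m ≤ t → 2 + m ≤ t
2≤t⇒3*m≤t⇒2+m≤t zero    2≤t _    = 2≤t
2≤t⇒3*m≤t⇒2+m≤t (suc m) _   3m≤t = begin
  3 + m          ≤⟨ m≤m+n (3 + m) (2 * m) ⟩
  3 + m + 2 * m  ≡⟨ solve (m ∷ []) ⟩
  3 * suc m      ≤⟨ 3m≤t ⟩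
  _              ∎
  where open ≤-Reasoning

3*m≤t⇒2*t*[2+k]≤3*[2+n]⇒2*m*k≤n : ∀ {t n k} m → 3 * m ≤ t → 2 * t * (2 + k) ≤ 3 * (2 + n) → 2 * m * k ≤ n
3*m≤t⇒2*t*[2+k]≤3*[2+n]⇒2*m*k≤n zero _ _ = z≤n
3*m≤t⇒2*t*[2+k]≤3*[2+n]⇒2*m*k≤n {t} {n} {k} (suc m) 3m≤t 2tk≤3n = +-cancelˡ-≤ 2 _ _ (begin
  2 + 2 * suc m * k                  ≤⟨ +-monoʳ-≤ 2 (m≤m+n _ (2 + 4 * m)) ⟩
  2 + (2 * suc m * k + (2 + 4 * m))  ≡⟨ solve (m ∷ k ∷ []) ⟩
  2 * suc m * (2 + k)                ≤⟨ *-cancelˡ-≤ 3 3*[2*m*[2+k]]≤3*[2+n] ⟩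
  2 + n                              ∎)
  where
  open ≤-Reasoning
  3*[2*m*[2+k]]≤3*[2+n] : 3 * (2 * suc m * (2 + k)) ≤ 3 * (2 + n)
  3*[2*m*[2+k]]≤3*[2+n] = begin
    3 * (2 * suc m * (2 + k))  ≡⟨ solve (m ∷ k ∷ []) ⟩
    2 * (3 * suc m) * (2 + k)  ≤⟨ *-monoˡ-≤ (2 + k) (*-monoʳ-≤ 2 3m≤t) ⟩
    2 * t * (2 + k)            ≤⟨ 2tk≤3n ⟩
    3 * (2 + n)                ∎

combine-bounds : ∀ k t n {X Y Z C g} →
  t ^ 2 ≤ 18 * C → k ^ 2 * X ≤ 2 * n ^ 2 * Y → Y ≤ 2 * Z → C * Z ≤ g →
  1 * (k * t) ^ 2 * X ≤ 72 * g * n ^ 2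
combine-bounds k t n {X} {Y} {Z} {C} {g} t²≤18C k²X≤2n²Y Y≤2Z CZ≤g = begin
  1 * ((k * t) * ((k * t) * 1)) * X      ≡⟨ solve (k ∷ t ∷ X ∷ []) ⟩
  t * (t * 1) * (k * (k * 1) * X)        ≤⟨ *-mono-≤ t²≤18C (≤-trans k²X≤2n²Y (*-monoʳ-≤ (2 * n ^ 2) Y≤2Z)) ⟩
  18 * C * (2 * (n * (n * 1)) * (2 * Z)) ≡⟨ solve (C ∷ n ∷ Z ∷ []) ⟩
  72 * (C * Z) * (n * (n * 1))           ≤⟨ *-monoˡ-≤ (n ^ 2) (*-monoʳ-≤ 72 CZ≤g) ⟩
  72 * g * n ^ 2                         ∎
  where open ≤-Reasoning

module _ {P : Pred A ℓ} (P? : Decidable P) where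

  filter-map : (f : B → A) (xs : List B) → filter P? (map f xs) ≡ map f (filter (P? ∘ f) xs)
  filter-map f []       = refl
  filter-map f (x ∷ xs) with does (P? (f x))
  ... | true  = cong (f x ∷_) (filter-map f xs)
  ... | false = filter-map f xs

card : ∀ {n} {P : Pred (Subset n) ℓ} → Decidable P → ℕ
card {n = n} P? = length (filter P? (allSubsets n))

module _ {n} {P : Pred (Subset n) ℓ} {Q : Pred (Subset n) ℓ′} (P? : Decidable P) (Q? : Decidable Q) where

  card-≐ : (∀ x → P x → Q x) → (∀ x → Q x → P x) → card P? ≡ card Q?
  card-≐ P⇒Q Q⇒P = cong length (filter-≐ P? Q? ((λ {x} → P⇒Q x) , (λ {x} → Q⇒P x)) (allSubsets n))

  card-mono : (∀ x → P x → Q x) → card P? ≤ card Q?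
  card-mono P⇒Q = Sublist.length-mono-≤
    (Sublist.filter⁺ P? Q? (λ { {x} refl → P⇒Q x }) (Sublist.⊆-refl {x = allSubsets n}))

card-none : ∀ {n} {P : Pred (Subset n) ℓ} (P? : Decidable P) → (∀ x → ¬ P x) → card P? ≡ 0
card-none {n = n} P? ¬P = cong length (filter-none P? (universal ¬P (allSubsets n)))

Splits : ∀ {n} → Subset n → ℕ → ℕ → Pred (Subset n) 0ℓ
Splits S i r x = ∣ x ∩ S ∣ ≡ i × ∣ x ─ S ∣ ≡ r

splits? : ∀ {n} (S : Subset n) i r → Decidable (Splits S i r)
splits? S i r x = (∣ x ∩ S ∣ ≟ i) ×-dec (∣ x ─ S ∣ ≟ r)

-- Vec's constructors are imported only here: in scope next to List's, they make the variable
-- lists passed to the ring solver above ambiguous, and elaboration then becomes very slow.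
module _ where
  open import Data.Vec.Base using ([]; _∷_)

  card-suc : ∀ {n} {P : Pred (Subset (suc n)) ℓ} (P? : Decidable P) →
             card P? ≡ card (P? ∘ (inside ∷_)) + card (P? ∘ (outside ∷_))
  card-suc {n = n} P? = begin
    length (filter P? (map (inside ∷_) xs ++ map (outside ∷_) xs))
      ≡⟨ cong length (filter-++ P? (map (inside ∷_) xs) _) ⟩
    length (filter P? (map (inside ∷_) xs) ++ filter P? (map (outside ∷_) xs))
      ≡⟨ length-++ (filter P? (map (inside ∷_) xs)) ⟩
    length (filter P? (map (inside ∷_) xs)) + length (filter P? (map (outside ∷_) xs))
      ≡⟨ cong₂ _+_ (card-map inside) (card-map outside) ⟩
    card (P? ∘ (inside ∷_)) + card (P? ∘ (outside ∷_)) ∎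
    where
    open ≡-Reasoning
    xs = allSubsets n
    card-map : ∀ b → length (filter P? (map (b ∷_) xs)) ≡ card (P? ∘ (b ∷_))
    card-map b = trans (cong length (filter-map P? (b ∷_) xs)) (length-map (b ∷_) (filter (P? ∘ (b ∷_)) xs))

  card-Splits : ∀ {n} (S : Subset n) i r → card (splits? S i r) ≡ (∣ S ∣ C i) * (∣ ∁ S ∣ C r)
  card-Splits []            zero    zero    = refl
  card-Splits []            zero    (suc r) = refl
  card-Splits []            (suc i) r       = refl
  card-Splits (inside ∷ S)  zero    r       = begin
    card (splits? (inside ∷ S) 0 r)            ≡⟨ card-suc (splits? (inside ∷ S) 0 r) ⟩
    card (splits? (inside ∷ S) 0 r ∘ (inside ∷_)) + card (splits? S 0 r)
      ≡⟨ cong (_+ card (splits? S 0 r))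
              (card-none (splits? (inside ∷ S) 0 r ∘ (inside ∷_)) (λ _ → 0≢1+n ∘ sym ∘ proj₁)) ⟩
    card (splits? S 0 r)                       ≡⟨ card-Splits S 0 r ⟩
    (∣ S ∣ C 0) * (∣ ∁ S ∣ C r)                ∎
    where open ≡-Reasoning
  card-Splits (inside ∷ S)  (suc i) r       = begin
    card (splits? (inside ∷ S) (suc i) r)      ≡⟨ card-suc (splits? (inside ∷ S) (suc i) r) ⟩
    card (splits? (inside ∷ S) (suc i) r ∘ (inside ∷_)) + card (splits? S (suc i) r)
      ≡⟨ cong₂ _+_ (card-≐ _ (splits? S i r) (λ _ → map₁ suc-injective) (λ _ → map₁ (cong suc)))
                   (card-Splits S (suc i) r) ⟩
    card (splits? S i r) + (∣ S ∣ C suc i) * c ≡⟨ cong (_+ (∣ S ∣ C suc i) * c) (card-Splits S i r) ⟩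
    (∣ S ∣ C i) * c + (∣ S ∣ C suc i) * c      ≡⟨ *-distribʳ-+ c (∣ S ∣ C i) _ ⟨
    (∣ S ∣ C i + ∣ S ∣ C suc i) * c            ≡⟨ cong (_* c) (nCk+nC[k+1]≡[n+1]C[k+1] ∣ S ∣ i) ⟩
    (suc ∣ S ∣ C suc i) * c                    ∎
    where
    open ≡-Reasoning
    c = ∣ ∁ S ∣ C r
  card-Splits (outside ∷ S) i       zero    = begin
    card (splits? (outside ∷ S) i 0)           ≡⟨ card-suc (splits? (outside ∷ S) i 0) ⟩
    card (splits? (outside ∷ S) i 0 ∘ (inside ∷_)) + card (splits? S i 0)
      ≡⟨ cong (_+ card (splits? S i 0))
              (card-none (splits? (outside ∷ S) i 0 ∘ (inside ∷_)) (λ _ → 0≢1+n ∘ sym ∘ proj₂)) ⟩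
    card (splits? S i 0)                       ≡⟨ card-Splits S i 0 ⟩
    (∣ S ∣ C i) * (∣ ∁ S ∣ C 0)                ∎
    where open ≡-Reasoning
  card-Splits (outside ∷ S) i       (suc r) = begin
    card (splits? (outside ∷ S) i (suc r))     ≡⟨ card-suc (splits? (outside ∷ S) i (suc r)) ⟩
    card (splits? (outside ∷ S) i (suc r) ∘ (inside ∷_)) + card (splits? S i (suc r))
      ≡⟨ cong₂ _+_ (card-≐ _ (splits? S i r) (λ _ → map₂ suc-injective) (λ _ → map₂ (cong suc)))
                   (card-Splits S i (suc r)) ⟩
    card (splits? S i r) + c * (∣ ∁ S ∣ C suc r) ≡⟨ cong (_+ c * (∣ ∁ S ∣ C suc r)) (card-Splits S i r) ⟩
    c * (∣ ∁ S ∣ C r) + c * (∣ ∁ S ∣ C suc r)  ≡⟨ *-distribˡ-+ c (∣ ∁ S ∣ C r) _ ⟨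
    c * (∣ ∁ S ∣ C r + ∣ ∁ S ∣ C suc r)        ≡⟨ cong (c *_) (nCk+nC[k+1]≡[n+1]C[k+1] ∣ ∁ S ∣ r) ⟩
    c * (suc ∣ ∁ S ∣ C suc r)                  ∎
    where
    open ≡-Reasoning
    c = ∣ S ∣ C i

  ∣p∣≡∣p∩q∣+∣p─q∣ : ∀ {n} (p q : Subset n) → ∣ p ∣ ≡ ∣ p ∩ q ∣ + ∣ p ─ q ∣
  ∣p∣≡∣p∩q∣+∣p─q∣ []            []            = refl
  ∣p∣≡∣p∩q∣+∣p─q∣ (inside  ∷ p) (inside  ∷ q) = cong suc (∣p∣≡∣p∩q∣+∣p─q∣ p q)
  ∣p∣≡∣p∩q∣+∣p─q∣ (inside  ∷ p) (outside ∷ q) =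
    trans (cong suc (∣p∣≡∣p∩q∣+∣p─q∣ p q)) (sym (+-suc ∣ p ∩ q ∣ _))
  ∣p∣≡∣p∩q∣+∣p─q∣ (outside ∷ p) (inside  ∷ q) = ∣p∣≡∣p∩q∣+∣p─q∣ p q
  ∣p∣≡∣p∩q∣+∣p─q∣ (outside ∷ p) (outside ∷ q) = ∣p∣≡∣p∩q∣+∣p─q∣ p q

  ∃-⊆-of-size : ∀ {n} t (S : Subset n) → t ≤ ∣ S ∣ → ∃[ T ] T ⊆ S × ∣ T ∣ ≡ t
  ∃-⊆-of-size {n} zero    S             _         = ⊥ , ⊆-min S , ∣⊥∣≡0 n
  ∃-⊆-of-size     (suc t) (inside ∷ S)  (s≤s t≤∣S∣) with ∃-⊆-of-size t S t≤∣S∣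
  ... | T , T⊆S , ∣T∣≡t = inside ∷ T , s⊆s T⊆S , cong suc ∣T∣≡t
  ∃-⊆-of-size     (suc t) (outside ∷ S) t<∣S∣       with ∃-⊆-of-size (suc t) S t<∣S∣
  ... | T , T⊆S , ∣T∣≡t = outside ∷ T , s⊆s T⊆S , ∣T∣≡t

∩-monoʳ-⊆ : ∀ {n} (x : Subset n) {S T} → T ⊆ S → x ∩ T ⊆ x ∩ S
∩-monoʳ-⊆ x {T = T} T⊆S i∈x∩T = x∈p∩q⁺ (map₂ T⊆S (x∈p∩q⁻ x T i∈x∩T))

sliceSize≡nCk : ∀ n k → sliceSize n k ≡ n C k
sliceSize≡nCk n k = begin
  sliceSize n k           ≡⟨ card-≐ size? (splits? [n] k 0) to from ⟩
  card (splits? [n] k 0)  ≡⟨ card-Splits [n] k 0 ⟩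
  (∣ [n] ∣ C k) * 1       ≡⟨ *-identityʳ _ ⟩
  ∣ [n] ∣ C k             ≡⟨ cong (_C k) (∣⊤∣≡n n) ⟩
  n C k                   ∎
  where
  open ≡-Reasoning
  [n] = ⊤ {n}
  size? : Decidable (λ (x : Subset n) → ∣ x ∣ ≡ k)
  size? x = ∣ x ∣ ≟ k
  ∣x∩[n]∣≡∣x∣ : ∀ x → ∣ x ∩ [n] ∣ ≡ ∣ x ∣
  ∣x∩[n]∣≡∣x∣ x = cong ∣_∣ (∩-identityʳ x)
  to : ∀ x → ∣ x ∣ ≡ k → Splits [n] k 0 x
  to x ∣x∣≡k = trans (∣x∩[n]∣≡∣x∣ x) ∣x∣≡k , trans (cong ∣_∣ (p─⊤≡⊥ x)) (∣⊥∣≡0 n)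
  from : ∀ x → Splits [n] k 0 x → ∣ x ∣ ≡ k
  from x (∣x∩[n]∣≡k , _) = trans (sym (∣x∩[n]∣≡∣x∣ x)) ∣x∩[n]∣≡k

sC2*[n∸s]Ck≤goodCount : ∀ n k (S : Subset n) s → s ≤ ∣ S ∣ → (s C 2) * ((n ∸ s) C k) ≤ goodCount n (2 + k) S
sC2*[n∸s]Ck≤goodCount n k S s s≤∣S∣ with ∃-⊆-of-size s S s≤∣S∣
... | T , T⊆S , refl = begin
  (∣ T ∣ C 2) * ((n ∸ ∣ T ∣) C k)  ≡⟨ cong (λ j → (∣ T ∣ C 2) * (j C k)) (∣∁p∣≡n∸∣p∣ T) ⟨
  (∣ T ∣ C 2) * (∣ ∁ T ∣ C k)      ≡⟨ card-Splits T 2 k ⟨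
  card (splits? T 2 k)             ≤⟨ card-mono (splits? T 2 k) good? good ⟩
  goodCount n (2 + k) S            ∎
  where
  open ≤-Reasoning
  good? : Decidable (λ (x : Subset n) → ∣ x ∣ ≡ 2 + k × 2 ≤ ∣ x ∩ S ∣)
  good? x = (∣ x ∣ ≟ 2 + k) ×-dec (2 ≤? ∣ x ∩ S ∣)
  good : ∀ x → Splits T 2 k x → ∣ x ∣ ≡ 2 + k × 2 ≤ ∣ x ∩ S ∣
  good x (∣x∩T∣≡2 , ∣x─T∣≡k) =
    trans (∣p∣≡∣p∩q∣+∣p─q∣ x T) (cong₂ _+_ ∣x∩T∣≡2 ∣x─T∣≡k) ,
    subst (_≤ ∣ x ∩ S ∣) ∣x∩T∣≡2 (p⊆q⇒∣p∣≤∣q∣ (∩-monoʳ-⊆ x T⊆S))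

lemma15 : Σ ℕ λ a → Σ ℕ λ b → 0 < a × 0 < b ×
            ((n k : ℕ) → 2 ≤ k → 2 * k ≤ n →
             (S : Subset n) → 2 ≤ ∣ S ∣ → 2 * ∣ S ∣ * k ≤ 3 * n →
             a * (k * ∣ S ∣) ^ 2 * sliceSize n k ≤ b * goodCount n k S * n ^ 2)
lemma15 = 1 , 72 , s≤s z≤n , s≤s z≤n , bound
  where
  bound : (n k : ℕ) → 2 ≤ k → 2 * k ≤ n → (S : Subset n) → 2 ≤ ∣ S ∣ → 2 * ∣ S ∣ * k ≤ 3 * n →
          1 * (k * ∣ S ∣) ^ 2 * sliceSize n k ≤ 72 * goodCount n k S * n ^ 2
  bound (suc (suc n)) (suc (suc k)) (s≤s (s≤s z≤n)) (s≤s (s≤s _)) S 2≤t 2tk≤3n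
    with ∃[m]3*m≤t≤2+3*m ∣ S ∣
  ... | m , 3m≤t , t≤2+3m rewrite sliceSize≡nCk (2 + n) (2 + k) =
    combine-bounds (2 + k) ∣ S ∣ (2 + n) {Z = (n ∸ m) C k} {C = (2 + m) C 2}
      (t≤2+3*m⇒t^2≤18*[2+m]C2 ∣ S ∣ m t≤2+3m)
      ([2+k]^2*[2+n]C[2+k]≤2*[2+n]^2*nCk n k)
      (2*m*k≤n⇒nCk≤2*[n∸m]Ck n m k (3*m≤t⇒2*t*[2+k]≤3*[2+n]⇒2*m*k≤n m 3m≤t 2tk≤3n))
      (sC2*[n∸s]Ck≤goodCount (2 + n) k S (2 + m) (2≤t⇒3*m≤t⇒2+m≤t m 2≤t 3m≤t))
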